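{- An approximable quasi-ats is an ats; i.e. if $\mathcal{A}$ is approximable, then for all $a,b,c\in A$, $a\Downarrow f$ and $b\lesssim^B c$ imply $f(b)\lesssim^B f(c)$.
   Context: A quasi-ats is $(A,ev)$ with $ev:A\rightharpoonup(A\to A)$; write $a\Downarrow f$ if $ev(a)=f$, $a\Uparrow$ if undefined, and $ab=f(b)$ if $a\Downarrow f$ ($ab=a$ if $a\Uparrow$). Applicative bisimulation $\lesssim^B$ is the largest relation $R$ such that $aRb$ and $a\Downarrow f$ imply $b\Downarrow g$ and $f(c)\,R\,g(c)$ for all $c\in A$. The logic $\mathcal{L}$ has formulas $\phi::=t\mid\phi\wedge\psi\mid(\phi\to\psi)_\bot$ ($t$ = true), with $a\models t$ always, conjunction as usual, and $a\models(\phi\to\psi)_\bot$ iff $a\Downarrow f$ and for all $b$, $b\models\phi$ implies $f(b)\models\psi$; $\lambda\equiv(t\to t)_\bot$. $\mathcal{A}$ is approximable if whenever $ab_1\cdots b_n\Downarrow$ there are $\phi_1,\dots,\phi_n\in\mathcal{L}$ with $a\models(\phi_1\to\cdots(\phi_n\to\lambda)_\bot\cdots)_\bot$ and $b_i\models\phi_i$. An applicative transition system (ats) is a quasi-ats such that $a\Downarrow f$ and $b\lesssim^B c$ imply $f(b)\lesssim^B f(c)$. -}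

module Defs where

open import Level using (Level; _⊔_; suc)
open import Data.Maybe using (Maybe; just; nothing)
open import Data.Product using (Σ; ∃; _×_; _,_)
open import Data.Unit.Polymorphic using (⊤)
open import Data.Nat using (ℕ)
open import Data.Vec using (Vec; foldl; foldr; []; _∷_)
open import Data.Vec.Relation.Binary.Pointwise.Inductive using (Pointwise)
open import Relation.Binary.PropositionalEquality using (_≡_)

record QuasiATS (ℓ : Level) : Set (suc ℓ) where
  field
    Carrier : Set ℓ
    ev      : Carrier → Maybe (Carrier → Carrier)

module _ {ℓ : Level} (𝒜 : QuasiATS ℓ) where
  open QuasiATS 𝒜

  _⇓_ : Carrier → (Carrier → Carrier) → Set ℓ
  a ⇓ f = ev a ≡ just f

  Conv : Carrier → Set ℓ
  Conv a = ∃ λ f → a ⇓ f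

  app : Carrier → Carrier → Carrier
  app a b with ev a
  ... | just f  = f b
  ... | nothing = a

  appMany : ∀ {n} → Carrier → Vec Carrier n → Carrier
  appMany a bs = foldl (λ _ → Carrier) app a bs

  IsAppSim : (Carrier → Carrier → Set ℓ) → Set ℓ
  IsAppSim R = ∀ a b → R a b → ∀ f → a ⇓ f →
    Σ (Carrier → Carrier) λ g → b ⇓ g × (∀ c → R (f c) (g c))

  -- applicative bisimulation ≲ᴮ: the largest such relation,
  -- i.e. the union of all applicative simulations
  _≲ᴮ_ : Carrier → Carrier → Set (suc ℓ)
  a ≲ᴮ b = Σ (Carrier → Carrier → Set ℓ) λ R → IsAppSim R × R a b

data Formula : Set where
  tt  : Formula
  _∧_ : Formula → Formula → Formula
  _⇒_ : Formula → Formula → Formula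

lam : Formula
lam = tt ⇒ tt

arrows : ∀ {n} → Vec Formula n → Formula
arrows φs = foldr (λ _ → Formula) _⇒_ lam φs

module _ {ℓ : Level} (𝒜 : QuasiATS ℓ) where
  open QuasiATS 𝒜

  _⊨_ : Carrier → Formula → Set ℓ
  a ⊨ tt      = ⊤
  a ⊨ (φ ∧ ψ) = (a ⊨ φ) × (a ⊨ ψ)
  a ⊨ (φ ⇒ ψ) = Σ (Carrier → Carrier) λ f →
    _⇓_ 𝒜 a f × (∀ b → b ⊨ φ → f b ⊨ ψ)

  Approximable : Set ℓ
  Approximable = ∀ (n : ℕ) (a : Carrier) (bs : Vec Carrier n) →
    Conv 𝒜 (appMany 𝒜 a bs) →
    Σ (Vec Formula n) λ φs → (a ⊨ arrows φs) × Pointwise _⊨_ bs φs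

module Submission where

-- Write x ⊑ y ("y converges in every applicative context in which x does")
-- when every convergent application x d₁ ⋯ dₙ has a convergent counterpart
-- y d₁ ⋯ dₙ.  The proof has three ingredients:
--   * ⊑ is an applicative simulation, hence ⊑ ⊆ ≲ᴮ;
--   * satisfaction of formulas of 𝓛 is upward closed along any applicative
--     simulation, in particular along ≲ᴮ;
--   * a ⊨ (φ₁ → ⋯ (φₙ → λ)⊥ ⋯)⊥ with dᵢ ⊨ φᵢ forces a d₁ ⋯ dₙ ⇓.
-- Given b ≲ᴮ c and a convergent a b d₁ ⋯ dₙ, approximability yields formulas
-- φ, φ₁ … φₙ with a ⊨ (φ → ⋯)⊥, b ⊨ φ and dᵢ ⊨ φᵢ; by upward closure c ⊨ φ,
-- so a c d₁ ⋯ dₙ converges.  Hence a b ⊑ a c, and if a ⇓ f this says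
-- f b ⊑ f c, so f b ≲ᴮ f c.

open import Defs
open import Level using (Level)
open import Relation.Binary.PropositionalEquality using (_≡_; refl; sym; cong; subst)
open import Data.Nat using (suc)
open import Data.Product using (_,_)
open import Data.Vec using (Vec; []; _∷_)
open import Data.Vec.Relation.Binary.Pointwise.Inductive using (Pointwise; []; _∷_)

module _ {ℓ : Level} (𝒜 : QuasiATS ℓ) where
  open QuasiATS 𝒜

  app-⇓ : ∀ {a f} → _⇓_ 𝒜 a f → ∀ b → app 𝒜 a b ≡ f b
  app-⇓ {a} a⇓f b rewrite a⇓f = refl

  appMany-⇓ : ∀ {n a f} → _⇓_ 𝒜 a f → ∀ b (ds : Vec Carrier n) →
              appMany 𝒜 a (b ∷ ds) ≡ appMany 𝒜 (f b) ds
  appMany-⇓ a⇓f b ds = cong (λ x → appMany 𝒜 x ds) (app-⇓ a⇓f b)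

  conv-unfold : ∀ {n a f} → _⇓_ 𝒜 a f → ∀ b (ds : Vec Carrier n) →
                Conv 𝒜 (appMany 𝒜 a (b ∷ ds)) → Conv 𝒜 (appMany 𝒜 (f b) ds)
  conv-unfold a⇓f b ds = subst (Conv 𝒜) (appMany-⇓ a⇓f b ds)

  conv-fold : ∀ {n a f} → _⇓_ 𝒜 a f → ∀ b (ds : Vec Carrier n) →
              Conv 𝒜 (appMany 𝒜 (f b) ds) → Conv 𝒜 (appMany 𝒜 a (b ∷ ds))
  conv-fold a⇓f b ds = subst (Conv 𝒜) (sym (appMany-⇓ a⇓f b ds))

  _⊑_ : Carrier → Carrier → Set ℓ
  x ⊑ y = ∀ n (ds : Vec Carrier n) →
          Conv 𝒜 (appMany 𝒜 x ds) → Conv 𝒜 (appMany 𝒜 y ds)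

  -- ⊑ is an applicative simulation: the empty context gives convergence of
  -- y, and a context for f(d) is a context for x extended by d.
  ⊑-isAppSim : IsAppSim 𝒜 _⊑_
  ⊑-isAppSim x y x⊑y f x⇓f with x⊑y 0 [] (f , x⇓f)
  ... | g , y⇓g = g , y⇓g , λ d n ds fd⇓ →
    conv-unfold y⇓g d ds (x⊑y (suc n) (d ∷ ds) (conv-fold x⇓f d ds fd⇓))

  ⊑⇒≲ᴮ : ∀ {x y} → x ⊑ y → _≲ᴮ_ 𝒜 x y
  ⊑⇒≲ᴮ x⊑y = _⊑_ , ⊑-isAppSim , x⊑y

  ⊨-sim : ∀ {R} → IsAppSim 𝒜 R → ∀ φ {x y} → R x y →
          _⊨_ 𝒜 x φ → _⊨_ 𝒜 y φ
  ⊨-sim sim tt       xRy x⊨ = x⊨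
  ⊨-sim sim (φ ∧ ψ)  xRy (x⊨φ , x⊨ψ) = ⊨-sim sim φ xRy x⊨φ , ⊨-sim sim ψ xRy x⊨ψ
  ⊨-sim sim (φ ⇒ ψ) {x} {y} xRy (f , x⇓f , f⊨) with sim x y xRy f x⇓f
  ... | g , y⇓g , fRg = g , y⇓g , λ d d⊨φ → ⊨-sim sim ψ (fRg d) (f⊨ d d⊨φ)

  ⊨-≲ᴮ : ∀ φ {x y} → _≲ᴮ_ 𝒜 x y → _⊨_ 𝒜 x φ → _⊨_ 𝒜 y φ
  ⊨-≲ᴮ φ (R , sim , xRy) = ⊨-sim sim φ xRy

  arrows-conv : ∀ {n} x {ds : Vec Carrier n} {φs : Vec Formula n} →
                _⊨_ 𝒜 x (arrows φs) → Pointwise (_⊨_ 𝒜) ds φs →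
                Conv 𝒜 (appMany 𝒜 x ds)
  arrows-conv x (f , x⇓f , _) [] = f , x⇓f
  arrows-conv x {d ∷ ds} (f , x⇓f , f⊨) (d⊨φ ∷ ds⊨φs) =
    conv-fold x⇓f d ds (arrows-conv (f d) (f⊨ d d⊨φ) ds⊨φs)

  approximable-congruence : Approximable 𝒜 → ∀ a {b c} → _≲ᴮ_ 𝒜 b c →
                            ∀ n (ds : Vec Carrier n) →
                            Conv 𝒜 (appMany 𝒜 a (b ∷ ds)) →
                            Conv 𝒜 (appMany 𝒜 a (c ∷ ds))
  approximable-congruence approx a b≲c n ds abds⇓
    with approx (suc n) a (_ ∷ ds) abds⇓
  ... | φ ∷ φs , a⊨ , b⊨φ ∷ ds⊨φs =
    arrows-conv a a⊨ (⊨-≲ᴮ φ b≲c b⊨φ ∷ ds⊨φs)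

mainTheorem18 : ∀ {ℓ : Level} (𝒜 : QuasiATS ℓ) → Approximable 𝒜 →
    ∀ (a b c : QuasiATS.Carrier 𝒜) (f : QuasiATS.Carrier 𝒜 → QuasiATS.Carrier 𝒜) →
    _⇓_ 𝒜 a f → _≲ᴮ_ 𝒜 b c → _≲ᴮ_ 𝒜 (f b) (f c)
mainTheorem18 𝒜 approx a b c f a⇓f b≲c = ⊑⇒≲ᴮ 𝒜 fb⊑fc
  where
  -- a context for f(b) is a context for a applied to b, and likewise for c
  fb⊑fc : _⊑_ 𝒜 (f b) (f c)
  fb⊑fc n ds fbds⇓ =
    conv-unfold 𝒜 a⇓f c ds
      (approximable-congruence 𝒜 approx a b≲c n ds (conv-fold 𝒜 a⇓f b ds fbds⇓))
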